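{- Let $G=(V,E)$ be a finite graph and $z$ a positive integer. Then $$ M_q(G,z)=\sum_{A\subseteq E} (-1)^{|A|} \prod_{W\in C(A)} (z)_{q^{|W|}}. $$
   Context: For a graph $G=(V,E)$ with $V=\{1,\dots,k\}$ and a positive integer $n$, $V(G,n)$ is the set of vectors $(v_1,\dots,v_k)$ with $0\le v_i\le n-1$ for all $i$ and $v_i\neq v_j$ whenever $\{i,j\}\in E$, and $M_q(G,n)=\sum_{(v_1,\dots,v_k)\in V(G,n)} q^{\sum_i v_i}$ (the $q$-chromatic function). For $A\subseteq E$, $C(A)$ is the set of connected components of the spanning subgraph $(V,A)$ (isolated vertices count as components), and $|W|$ is the number of vertices of a component $W$. For an integer $m$, $(m)_q=\frac{q^m-1}{q-1}$; thus $(z)_{q^{|W|}}=\frac{q^{|W|z}-1}{q^{|W|}-1}=\sum_{x=0}^{z-1}q^{|W|x}$. -}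

module Defs where

open import Data.Bool using (Bool; true; false; if_then_else_; _∧_; _∨_; not)
open import Data.Nat as ℕ using (ℕ; zero; suc; _≡ᵇ_)
open import Data.Fin using (Fin; toℕ)
open import Data.Integer using (ℤ; _+_; _*_; _^_; -_; +_)
open import Data.List using (List; []; _∷_; _++_; map; foldr; length; filter; upTo; allFin; concatMap)
open import Data.Bool.ListAction using (all; any)
open import Data.Vec as Vec using (Vec; lookup)
open import Data.Product using (_×_; _,_; proj₁; proj₂)

-- A graph on the vertex set Fin k is given by its list of edges.
Edge : ℕ → Set
Edge k = Fin k × Fin k

_=ᶠ_ : ∀ {k} → Fin k → Fin k → Bool
i =ᶠ j = toℕ i ≡ᵇ toℕ j

sumℤ : List ℤ → ℤ
sumℤ = foldr _+_ (+ 0)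

prodℤ : List ℤ → ℤ
prodℤ = foldr _*_ (+ 1)

vectors : (n k : ℕ) → List (Vec ℕ k)
vectors n zero = Vec.[] ∷ []
vectors n (suc k) = concatMap (λ x → map (x Vec.∷_) (vectors n k)) (upTo n)

proper : ∀ {k} → List (Edge k) → Vec ℕ k → Bool
proper E v = all (λ e → not (lookup v (proj₁ e) ≡ᵇ lookup v (proj₂ e))) E

Mq : ∀ {k} → List (Edge k) → ℕ → ℤ → ℤ
Mq {k} E n q =
  sumℤ (map (λ v → if proper E v then q ^ Vec.sum v else + 0) (vectors n k))

subsets : ∀ {a} {X : Set a} → List X → List (List X)
subsets [] = [] ∷ []
subsets (x ∷ xs) = subsets xs ++ map (x ∷_) (subsets xs)

reachIn : ∀ {k} → ℕ → List (Edge k) → Fin k → Fin k → Bool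
reachIn zero A i j = i =ᶠ j
reachIn (suc t) A i j =
  reachIn t A i j ∨
  any (λ e → (reachIn t A i (proj₁ e) ∧ (proj₂ e =ᶠ j)) ∨
             (reachIn t A i (proj₂ e) ∧ (proj₁ e =ᶠ j))) A

-- i and j lie in the same connected component of (V,A)
-- (a path in a graph with k vertices has length < k)
connected : ∀ {k} → List (Edge k) → Fin k → Fin k → Bool
connected {k} A = reachIn k A

component : ∀ {k} → List (Edge k) → Fin k → List (Fin k)
component {k} A i = filter (λ j → connected A i j Data.Bool.≟ true) (allFin k)
  where import Data.Bool

isRep : ∀ {k} → List (Edge k) → Fin k → Bool
isRep {k} A i = not (any (λ j → (toℕ j ℕ.<ᵇ toℕ i) ∧ connected A i j) (allFin k))

componentSizes : ∀ {k} → List (Edge k) → List ℕ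
componentSizes {k} A =
  map (λ i → length (component A i))
      (filter (λ i → isRep A i Data.Bool.≟ true) (allFin k))
  where import Data.Bool

qint : ℕ → ℕ → ℤ → ℤ
qint m z q = sumℤ (map (λ x → q ^ (m ℕ.* x)) (upTo z))

rhs : ∀ {k} → List (Edge k) → ℕ → ℤ → ℤ
rhs E z q =
  sumℤ (map (λ A → ((- (+ 1)) ^ length A) *
                   prodℤ (map (λ m → qint m z q) (componentSizes A)))
            (subsets E))

-- Writing the indicator of a proper colouring v as ∏_{e ∈ E} (1 - [v is constant on e])
-- and expanding gives M_q(G,z) = Σ_{A ⊆ E} (-1)^|A| Σ_v [v is constant on every edge of A] q^(Σ v).
-- A colouring is constant on the edges of A iff it is constant on the components of (V,A), and
-- the sum of q^(Σ v) over such colourings factorises over the components W, each contributing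
-- Σ_{x<z} q^(|W| x) = (z)_{q^|W|}. The factorisation is proved for any equivalence relation on
-- weighted vertices by induction on the number of vertices: vertex 0 either forms a class of its
-- own, contributing one factor, or is merged into the least other vertex of its class, which
-- inherits its weight.

{-# OPTIONS --safe #-}
module Submission where

open import Defs
open import Data.Nat using (ℕ; _≤_)
open import Data.Fin using (_<_)
open import Data.Integer using (ℤ)
open import Data.List using (List)
open import Data.List.Relation.Unary.All using (All)
open import Data.List.Relation.Unary.All using ([]; _∷_)
open import Data.List.Relation.Unary.Unique.Propositional using (Unique)
open import Data.Product using (proj₁; proj₂)
open import Relation.Binary.PropositionalEquality using (_≡_)

open import Algebra.Bundles using (Monoid)
open import Algebra.Properties.CommutativeSemigroup using (interchange)
import Algebra.Properties.CommutativeMonoid.Sum as CommutativeMonoidSum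
import Algebra.Properties.Monoid.Sum as MonoidSum
import Data.Bool as Bool
open import Data.Bool using (Bool; true; false; T; if_then_else_; not; _∧_; _∨_)
open import Data.Bool.ListAction using (all; any; or)
open import Data.Bool.Properties
  using (T-≡; T-∧; T-∨; if-float; if-∧; if-swap-then; if-eta; if-cong; if-cong-then)
open import Data.Fin using (Fin; toℕ; zero; suc)
import Data.Fin.Properties as Fin
open import Data.Fin.Subset using (Subset; ∣_∣) renaming (_∈_ to _∈ₛ_)
open import Data.Fin.Subset.Properties using (_⊂?_; p⊂q⇒∣p∣<∣q∣; ∣p∣≤n)
open import Data.Integer using (0ℤ; 1ℤ; -1ℤ; _+_; _*_; -_; _^_)
import Data.Integer.Properties as ℤ
open import Data.List using ([]; _∷_; _++_; map; concatMap; length; filter; tabulate; allFin; upTo)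
import Data.List.Properties as List
open import Data.List.Membership.Propositional using (_∈_; lose; find)
open import Data.List.Membership.Propositional.Properties using (∈-allFin)
import Data.List.Relation.Unary.All as All
open import Data.List.Relation.Unary.All.Properties using (all⁺; all⁻; concat⁺; map⁺)
open import Data.List.Relation.Unary.AllPairs using (_∷_)
open import Data.List.Relation.Unary.Any using (here; there; satisfied)
open import Data.List.Relation.Unary.Any.Properties using (any⁺; any⁻)
open import Data.List.Relation.Unary.Unique.Propositional.Properties using (upTo⁺)
import Data.Nat as ℕ
open import Data.Nat using (zero; suc)
import Data.Nat.Properties as ℕ
open import Data.Product using (_×_; _,_; ∃-syntax)
open import Data.Sum using (_⊎_; inj₁; inj₂)
import Data.Vec as Vec
open import Data.Vec using (Vec; lookup) renaming ([] to []ᵛ; _∷_ to _∷ᵛ_)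
import Data.Vec.Properties as Vec
open import Function using (_∘_; id; _on_; _⇔_; mk⇔; Equivalence)
open import Level using (Level)
open import Relation.Binary.Construct.Closure.Equivalence using (EqClosure)
import Relation.Binary.Construct.Closure.Equivalence as EqClosure
open import Relation.Binary.Construct.Closure.ReflexiveTransitive using (_◅_; _◅◅_)
import Relation.Binary.Construct.Closure.ReflexiveTransitive as Star
open import Relation.Binary.Construct.Closure.Symmetric using (SymClosure; fwd; bwd)
import Relation.Binary.Construct.On as On
open import Relation.Binary.Definitions using (DecidableEquality; tri<; tri≈; tri>)
import Relation.Binary.PropositionalEquality as ≡
open import Relation.Binary.PropositionalEquality
  using (refl; sym; trans; cong; cong₂; subst; _≗_; module ≡-Reasoning)
open import Relation.Binary.Structures using (IsEquivalence)
open import Relation.Nullary using (Dec; does; _because_; ofʸ; ofⁿ; yes; no; ¬_; contradiction)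
open import Relation.Nullary.Decidable using (T?; _→-dec_; does-⇔; dec-true; dec-false; decidable-stable)
open import Relation.Unary using (_⊆_)

open Equivalence using (to; from)
open ≡-Reasoning

private
  variable
    a ℓ : Level
    A B : Set a
    P : Set ℓ
    b c : Bool
    k : ℕ

T⇒≡true : T b → b ≡ true
T⇒≡true = to T-≡

¬T⇒≡false : ¬ T b → b ≡ false
¬T⇒≡false {false} _  = refl
¬T⇒≡false {true}  ¬t = contradiction _ ¬t

T-injective : T b ⇔ T c → b ≡ c
T-injective {b} {c} b⇔c = does-⇔ b⇔c (T? b) (T? c)

T-does : (d : Dec P) → T (does d) ⇔ P
T-does (true  because ofʸ  p) = mk⇔ (λ _ → p) _
T-does (false because ofⁿ ¬p) = mk⇔ (λ ()) ¬p

if-*ˡ : ∀ b (x y : ℤ) → (if b then x * y else 0ℤ) ≡ x * (if b then y else 0ℤ)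
if-*ˡ true  x y = refl
if-*ˡ false x y = sym (ℤ.*-zeroʳ x)

-- Finite sums

∑ : List A → (A → ℤ) → ℤ
∑ xs f = sumℤ (map f xs)

syntax ∑ xs (λ x → f) = ∑[ x ∈ xs ] f

∑-++ : (xs ys : List A) (f : A → ℤ) → ∑ (xs ++ ys) f ≡ ∑ xs f + ∑ ys f
∑-++ []       ys f = sym (ℤ.+-identityˡ _)
∑-++ (x ∷ xs) ys f = trans (cong (f x +_) (∑-++ xs ys f)) (sym (ℤ.+-assoc (f x) _ _))

∑-map : (g : B → A) (xs : List B) (f : A → ℤ) → ∑ (map g xs) f ≡ ∑ xs (f ∘ g)
∑-map g xs f = cong sumℤ (sym (List.map-∘ xs))

∑-concatMap : (g : A → List B) (xs : List A) (f : B → ℤ) →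
              ∑ (concatMap g xs) f ≡ ∑[ x ∈ xs ] ∑ (g x) f
∑-concatMap g []       f = refl
∑-concatMap g (x ∷ xs) f =
  trans (∑-++ (g x) (concatMap g xs) f) (cong (∑ (g x) f +_) (∑-concatMap g xs f))

∑-cong : (xs : List A) {f g : A → ℤ} → f ≗ g → ∑ xs f ≡ ∑ xs g
∑-cong xs f≗g = cong sumℤ (List.map-cong f≗g xs)

∑-cong-∈ : (xs : List A) {f g : A → ℤ} → (∀ {x} → x ∈ xs → f x ≡ g x) → ∑ xs f ≡ ∑ xs g
∑-cong-∈ xs f≡g = cong sumℤ (List.map-cong-local (All.tabulate f≡g))

∑-zero : (xs : List A) → ∑[ x ∈ xs ] 0ℤ ≡ 0ℤ
∑-zero []       = refl
∑-zero (x ∷ xs) = trans (ℤ.+-identityˡ _) (∑-zero xs)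

∑-distrib-+ : (xs : List A) (f g : A → ℤ) → ∑[ x ∈ xs ] (f x + g x) ≡ ∑ xs f + ∑ xs g
∑-distrib-+ []       f g = refl
∑-distrib-+ (x ∷ xs) f g = trans (cong (f x + g x +_) (∑-distrib-+ xs f g))
                                 (interchange ℤ.+-commutativeSemigroup (f x) (g x) _ _)

∑-comm : (xs : List A) (ys : List B) (f : A → B → ℤ) →
         ∑[ x ∈ xs ] ∑ ys (f x) ≡ ∑[ y ∈ ys ] ∑[ x ∈ xs ] f x y
∑-comm []       ys f = sym (∑-zero ys)
∑-comm (x ∷ xs) ys f = trans (cong (∑ ys (f x) +_) (∑-comm xs ys f))
                             (sym (∑-distrib-+ ys (f x) (λ y → ∑[ x ∈ xs ] f x y)))

*-distribˡ-∑ : ∀ c (xs : List A) (f : A → ℤ) → c * ∑ xs f ≡ ∑[ x ∈ xs ] (c * f x)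
*-distribˡ-∑ c []       f = ℤ.*-zeroʳ c
*-distribˡ-∑ c (x ∷ xs) f =
  trans (ℤ.*-distribˡ-+ c (f x) _) (cong (c * f x +_) (*-distribˡ-∑ c xs f))

*-distribʳ-∑ : ∀ c (xs : List A) (f : A → ℤ) → ∑ xs f * c ≡ ∑[ x ∈ xs ] (f x * c)
*-distribʳ-∑ c xs f = begin
  ∑ xs f * c            ≡⟨ ℤ.*-comm (∑ xs f) c ⟩
  c * ∑ xs f            ≡⟨ *-distribˡ-∑ c xs f ⟩
  ∑[ x ∈ xs ] (c * f x) ≡⟨ ∑-cong xs (λ x → ℤ.*-comm c (f x)) ⟩
  ∑[ x ∈ xs ] (f x * c) ∎

module _ (_≟_ : DecidableEquality A) where

  ∑-select : ∀ {xs y} → Unique xs → y ∈ xs → (h : A → ℤ) →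
             ∑[ x ∈ xs ] (if does (y ≟ x) then h x else 0ℤ) ≡ h y
  ∑-select {x ∷ xs} (x∉xs ∷ _) (here refl) h = begin
    (if does (x ≟ x) then h x else 0ℤ) + ∑ xs _
      ≡⟨ cong₂ _+_ (if-cong (dec-true (x ≟ x) refl)) others ⟩
    h x + 0ℤ
      ≡⟨ ℤ.+-identityʳ (h x) ⟩
    h x ∎
    where
    others : ∑[ x′ ∈ xs ] (if does (x ≟ x′) then h x′ else 0ℤ) ≡ 0ℤ
    others = trans (∑-cong-∈ xs (λ x′∈xs → if-cong (dec-false (x ≟ _) (All.lookup x∉xs x′∈xs))))
                   (∑-zero xs)
  ∑-select {x ∷ xs} {y} (x∉xs ∷ unique) (there y∈xs) h = begin
    (if does (y ≟ x) then h x else 0ℤ) + ∑ xs _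
      ≡⟨ cong (_+ ∑ xs _) (if-cong (dec-false (y ≟ x) (All.lookup x∉xs y∈xs ∘ sym))) ⟩
    0ℤ + ∑ xs _
      ≡⟨ ℤ.+-identityˡ _ ⟩
    ∑ xs _
      ≡⟨ ∑-select unique y∈xs h ⟩
    h y ∎

module Sumℕ = CommutativeMonoidSum ℕ.+-0-commutativeMonoid
open Sumℕ using (sum-syntax)
module Productℤ = CommutativeMonoidSum ℤ.*-1-commutativeMonoid

∏ : ∀ {n} → (Fin n → ℤ) → ℤ
∏ = Productℤ.sum

module _ {c ℓ} (M : Monoid c ℓ) where
  open Monoid M using (Carrier; _≈_; ε; ∙-congˡ; identityˡ; identityʳ) renaming (trans to ≈-trans)
  open MonoidSum M using (sum; sum-replicate-zero)

  sum-select : ∀ {n} (j : Fin n) (f : Fin n → Carrier) →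
               sum (λ i → if does (i Fin.≟ j) then f i else ε) ≈ f j
  sum-select {suc n} zero    f = ≈-trans (∙-congˡ (sum-replicate-zero n)) (identityʳ (f zero))
  sum-select {suc n} (suc j) f = ≈-trans (identityˡ _) (sum-select j (f ∘ suc))

-- Inclusion–exclusion

∑-subsets-∷ : (e : A) (E : List A) (g : List A → ℤ) →
              ∑ (subsets (e ∷ E)) g ≡ ∑ (subsets E) g + ∑[ S ∈ subsets E ] g (e ∷ S)
∑-subsets-∷ e E g =
  trans (∑-++ (subsets E) _ g) (cong (∑ (subsets E) g +_) (∑-map (e ∷_) (subsets E) g))

inclusion-exclusion : (p : A → Bool) (x : ℤ) (E : List A) →
  (if all (not ∘ p) E then x else 0ℤ) ≡
  ∑[ S ∈ subsets E ] (-1ℤ ^ length S * (if all p S then x else 0ℤ))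
inclusion-exclusion p x []      = sym (trans (ℤ.+-identityʳ _) (ℤ.*-identityˡ x))
inclusion-exclusion p x (e ∷ E) = trans (by-cases (p e)) (sym (∑-subsets-∷ e E term))
  where
  term : List _ → ℤ
  term S = -1ℤ ^ length S * (if all p S then x else 0ℤ)
  rest = ∑ (subsets E) term
  by-cases : ∀ b → (if not b ∧ all (not ∘ p) E then x else 0ℤ)
                 ≡ rest + ∑[ S ∈ subsets E ] (-1ℤ ^ suc (length S) * (if b ∧ all p S then x else 0ℤ))
  by-cases true = begin
    0ℤ                                          ≡⟨ ℤ.+-inverseʳ rest ⟨
    rest + - rest                               ≡⟨ cong (rest +_) (ℤ.-1*i≡-i rest) ⟨
    rest + -1ℤ * rest                           ≡⟨ cong (rest +_) (*-distribˡ-∑ -1ℤ (subsets E) term) ⟩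
    rest + ∑[ S ∈ subsets E ] (-1ℤ * term S)
      ≡⟨ cong (rest +_) (∑-cong (subsets E) (λ S → ℤ.*-assoc -1ℤ (-1ℤ ^ length S) _)) ⟨
    rest + ∑[ S ∈ subsets E ] (-1ℤ ^ suc (length S) * (if all p S then x else 0ℤ)) ∎
  by-cases false = begin
    (if all (not ∘ p) E then x else 0ℤ)         ≡⟨ inclusion-exclusion p x E ⟩
    rest                                        ≡⟨ ℤ.+-identityʳ rest ⟨
    rest + 0ℤ                                   ≡⟨ cong (rest +_) (∑-zero (subsets E)) ⟨
    rest + ∑[ S ∈ subsets E ] 0ℤ
      ≡⟨ cong (rest +_) (∑-cong (subsets E) (λ S → ℤ.*-zeroʳ (-1ℤ ^ suc (length S)))) ⟨
    rest + ∑[ S ∈ subsets E ] (-1ℤ ^ suc (length S) * 0ℤ) ∎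

-- Colourings constant on the classes of an equivalence relation

∑-vectors-suc : (n : ℕ) (F : Vec ℕ (suc k) → ℤ) →
                ∑ (vectors n (suc k)) F ≡ ∑[ x ∈ upTo n ] ∑[ v ∈ vectors n k ] F (x ∷ᵛ v)
∑-vectors-suc {k} n F =
  trans (∑-concatMap _ (upTo n) F) (∑-cong (upTo n) (λ x → ∑-map (x ∷ᵛ_) (vectors n k) F))

vectors-bounded : ∀ n k → All (λ v → ∀ i → lookup v i ∈ upTo n) (vectors n k)
vectors-bounded n zero    = (λ ()) ∷ []
vectors-bounded n (suc k) = concat⁺ (map⁺ (All.tabulate λ x∈ → map⁺ (All.map (λ bounded → λ where
  zero    → x∈
  (suc i) → bounded i) (vectors-bounded n k))))

infix 7 _·_

_·_ : (Fin k → ℕ) → Vec ℕ k → ℕ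
_·_ {k} w v = ∑[ i < k ] (w i ℕ.* lookup v i)

·-const-1 : (v : Vec ℕ k) → (λ _ → 1) · v ≡ Vec.sum v
·-const-1 []ᵛ       = refl
·-const-1 (x ∷ᵛ v) = cong₂ ℕ._+_ (ℕ.*-identityˡ x) (·-const-1 v)

δ : Fin k → ℕ → Fin k → ℕ
δ j₀ x j = if does (j Fin.≟ j₀) then x else 0

contract : Fin k → (Fin (suc k) → ℕ) → Fin k → ℕ
contract j₀ w j = w (suc j) ℕ.+ δ j₀ (w zero) j

·-contract : (j₀ : Fin k) (w : Fin (suc k) → ℕ) (v : Vec ℕ k) →
             contract j₀ w · v ≡ (w ∘ suc) · v ℕ.+ w zero ℕ.* lookup v j₀
·-contract {k} j₀ w v = begin
  contract j₀ w · v
    ≡⟨ Sumℕ.sum-cong-≗ (λ i → ℕ.*-distribʳ-+ (lookup v i) (w (suc i)) _) ⟩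
  ∑[ i < k ] (w (suc i) ℕ.* lookup v i ℕ.+ δ j₀ (w zero) i ℕ.* lookup v i)
    ≡⟨ Sumℕ.∑-distrib-+ (λ i → w (suc i) ℕ.* lookup v i) _ ⟩
  (w ∘ suc) · v ℕ.+ ∑[ i < k ] (δ j₀ (w zero) i ℕ.* lookup v i)
    ≡⟨ cong ((w ∘ suc) · v ℕ.+_)
            (Sumℕ.sum-cong-≗ (λ i → if-float (ℕ._* lookup v i) (does (i Fin.≟ j₀)))) ⟩
  (w ∘ suc) · v ℕ.+ ∑[ i < k ] (if does (i Fin.≟ j₀) then w zero ℕ.* lookup v i else 0)
    ≡⟨ cong ((w ∘ suc) · v ℕ.+_) (sum-select ℕ.+-0-monoid j₀ (λ i → w zero ℕ.* lookup v i)) ⟩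
  (w ∘ suc) · v ℕ.+ w zero ℕ.* lookup v j₀ ∎

classWeight : (Fin k → Fin k → Bool) → (Fin k → ℕ) → Fin k → ℕ
classWeight {k} R w i = ∑[ j < k ] (if R i j then w j else 0)

classWeight-+ : (R : Fin k → Fin k → Bool) (u w : Fin k → ℕ) (i : Fin k) →
                classWeight R (λ j → u j ℕ.+ w j) i ≡ classWeight R u i ℕ.+ classWeight R w i
classWeight-+ R u w i =
  trans (Sumℕ.sum-cong-≗ (λ j → split (R i j))) (Sumℕ.∑-distrib-+ (λ j → if R i j then u j else 0) _)
  where
  split : ∀ {j} b → (if b then u j ℕ.+ w j else 0) ≡ (if b then u j else 0) ℕ.+ (if b then w j else 0)
  split true  = refl
  split false = refl

classWeight-δ : (R : Fin k → Fin k → Bool) (j₀ : Fin k) (x : ℕ) (i : Fin k) →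
                classWeight R (δ j₀ x) i ≡ (if R i j₀ then x else 0)
classWeight-δ R j₀ x i =
  trans (Sumℕ.sum-cong-≗ pointwise) (sum-select ℕ.+-0-monoid j₀ (λ _ → if R i j₀ then x else 0))
  where
  pointwise : ∀ j → (if R i j then (if does (j Fin.≟ j₀) then x else 0) else 0)
                  ≡ (if does (j Fin.≟ j₀) then (if R i j₀ then x else 0) else 0)
  pointwise j with j Fin.≟ j₀
  ... | yes refl = refl
  ... | no  _    = if-eta (R i j)

classWeight-suc : (R : Fin (suc k) → Fin (suc k) → Bool) (w : Fin (suc k) → ℕ) {i : Fin k} →
  ¬ T (R (suc i) zero) → classWeight R w (suc i) ≡ classWeight (R on suc) (w ∘ suc) i
classWeight-suc R w {i} ¬r =
  cong (λ b → (if b then w zero else 0) ℕ.+ classWeight (R on suc) (w ∘ suc) i) (¬T⇒≡false ¬r)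

-- Definitionally equal to isRep A when R is connected A.
isLeast : (Fin k → Fin k → Bool) → Fin k → Bool
isLeast {k} R i = not (any (λ j → (toℕ j ℕ.<ᵇ toℕ i) ∧ R i j) (allFin k))

module _ {R : Fin k → Fin k → Bool} {i : Fin k} where

  isLeast⁺ : (∀ {j} → j < i → ¬ T (R i j)) → isLeast R i ≡ true
  isLeast⁺ least = cong not (¬T⇒≡false no-smaller)
    where
    no-smaller : ¬ T (any (λ j → (toℕ j ℕ.<ᵇ toℕ i) ∧ R i j) (allFin k))
    no-smaller t with j , smaller ← satisfied (any⁻ _ (allFin k) t)
                 with j<ᵇi , rij ← to T-∧ smaller
      = least (ℕ.<ᵇ⇒< (toℕ j) (toℕ i) j<ᵇi) rij

  isLeast⁻ : ∀ {j} → j < i → T (R i j) → isLeast R i ≡ false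
  isLeast⁻ {j} j<i rij =
    cong not (T⇒≡true (any⁺ _ (lose (∈-allFin j) (from T-∧ (ℕ.<⇒<ᵇ j<i , rij)))))

isLeast-suc : (R : Fin (suc k) → Fin (suc k) → Bool) {i : Fin k} →
  ¬ T (R (suc i) zero) → isLeast R (suc i) ≡ isLeast (R on suc) i
isLeast-suc R {i} ¬r = cong₂ (λ b bs → not (b ∨ or bs)) (¬T⇒≡false ¬r)
  (trans (List.map-tabulate suc smaller) (sym (List.map-tabulate id (smaller ∘ suc))))
  where
  smaller : Fin (suc _) → Bool
  smaller j = (toℕ j ℕ.<ᵇ toℕ (suc i)) ∧ R (suc i) j

respects? : (R : Fin k → Fin k → Bool) (v : Vec ℕ k) → Dec (∀ i j → T (R i j) → lookup v i ≡ lookup v j)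
respects? R v = Fin.all? λ i → Fin.all? λ j → T? (R i j) →-dec lookup v i ℕ.≟ lookup v j

respects : (Fin k → Fin k → Bool) → Vec ℕ k → Bool
respects R v = does (respects? R v)

respects-⇔ : (R : Fin k → Fin k → Bool) (v : Vec ℕ k) →
             T (respects R v) ⇔ (∀ i j → T (R i j) → lookup v i ≡ lookup v j)
respects-⇔ R v = T-does (respects? R v)

smallest-or-none : (P : Fin k → Bool) →
                   (∀ j → ¬ T (P j)) ⊎ ∃[ j₀ ] (T (P j₀) × ∀ {j} → j < j₀ → ¬ T (P j))
smallest-or-none {zero}  P = inj₁ λ ()
smallest-or-none {suc k} P with T? (P zero) | smallest-or-none (P ∘ suc)
... | yes p₀ | _                        = inj₂ (zero , p₀ , λ ())
... | no ¬p₀ | inj₁ none                = inj₁ λ { zero → ¬p₀ ; (suc j) → none j }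
... | no ¬p₀ | inj₂ (j₀ , p , smallest) =
  inj₂ (suc j₀ , p , λ { {zero} _ → ¬p₀ ; {suc j} j<j₀ → smallest (ℕ.s<s⁻¹ j<j₀) })

module _ {R : Fin (suc k) → Fin (suc k) → Bool} (R-equiv : IsEquivalence (λ i j → T (R i j))) where
  open IsEquivalence R-equiv renaming (refl to R-refl; sym to R-sym; trans to R-trans)

  private
    R′ : Fin k → Fin k → Bool
    R′ = R on suc

  respects-tail : ∀ {x v} → T (respects R (x ∷ᵛ v)) → T (respects R′ v)
  respects-tail {x} {v} h =
    from (respects-⇔ R′ v) λ i j → to (respects-⇔ R (x ∷ᵛ v)) h (suc i) (suc j)

  respects-∷-isolated : (∀ j → ¬ T (R zero (suc j))) → ∀ x v →
                        respects R (x ∷ᵛ v) ≡ respects R′ v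
  respects-∷-isolated isolated x v = T-injective (mk⇔ respects-tail extend)
    where
    extend : T (respects R′ v) → T (respects R (x ∷ᵛ v))
    extend h = from (respects-⇔ R (x ∷ᵛ v)) λ where
      zero    zero    _ → refl
      zero    (suc j) r → contradiction r (isolated j)
      (suc i) zero    r → contradiction (R-sym r) (isolated i)
      (suc i) (suc j) r → to (respects-⇔ R′ v) h i j r

  respects-∷-joined : ∀ {j₀} → T (R zero (suc j₀)) → ∀ x v →
                      respects R (x ∷ᵛ v) ≡ respects R′ v ∧ does (lookup v j₀ ℕ.≟ x)
  respects-∷-joined {j₀} r₀ x v = T-injective (mk⇔ restrict extend)
    where
    restrict : T (respects R (x ∷ᵛ v)) → T (respects R′ v ∧ does (lookup v j₀ ℕ.≟ x))
    restrict h = from T-∧ (respects-tail h ,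
      from (T-does (lookup v j₀ ℕ.≟ x)) (sym (to (respects-⇔ R (x ∷ᵛ v)) h zero (suc j₀) r₀)))
    extend : T (respects R′ v ∧ does (lookup v j₀ ℕ.≟ x)) → T (respects R (x ∷ᵛ v))
    extend h = from (respects-⇔ R (x ∷ᵛ v)) constant
      where
      resp = to (respects-⇔ R′ v) (proj₁ (to T-∧ h))
      v₀≡x = to (T-does (lookup v j₀ ℕ.≟ x)) (proj₂ (to (T-∧ {respects R′ v}) h))
      constant : ∀ i j → T (R i j) → lookup (x ∷ᵛ v) i ≡ lookup (x ∷ᵛ v) j
      constant zero    zero    _ = refl
      constant zero    (suc j) r = trans (sym v₀≡x) (resp j₀ j (R-trans (R-sym r₀) r))
      constant (suc i) zero    r = trans (resp i j₀ (R-trans r r₀)) v₀≡x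
      constant (suc i) (suc j) r = resp i j r

  classWeight-isolated : (∀ j → ¬ T (R zero (suc j))) → (w : Fin (suc k) → ℕ) →
                         classWeight R w zero ≡ w zero
  classWeight-isolated isolated w = begin
    (if R zero zero then w zero else 0) ℕ.+ ∑[ j < k ] (if R zero (suc j) then w (suc j) else 0)
      ≡⟨ cong₂ ℕ._+_ (if-cong (T⇒≡true R-refl))
                     (Sumℕ.sum-cong-≗ {k} (λ j → if-cong (¬T⇒≡false (isolated j)))) ⟩
    w zero ℕ.+ ∑[ j < k ] 0
      ≡⟨ cong (w zero ℕ.+_) (Sumℕ.sum-replicate-zero k) ⟩
    w zero ℕ.+ 0
      ≡⟨ ℕ.+-identityʳ (w zero) ⟩
    w zero ∎

  classWeight-contract : ∀ {j₀} → T (R zero (suc j₀)) → (w : Fin (suc k) → ℕ) →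
                         classWeight R′ (contract j₀ w) j₀ ≡ classWeight R w zero
  classWeight-contract {j₀} r₀ w = begin
    classWeight R′ (contract j₀ w) j₀
      ≡⟨ classWeight-+ R′ (w ∘ suc) _ j₀ ⟩
    classWeight R′ (w ∘ suc) j₀ ℕ.+ classWeight R′ (δ j₀ (w zero)) j₀
      ≡⟨ cong₂ ℕ._+_ (Sumℕ.sum-cong-≗ {k} (λ j → if-cong (same-class j)))
                     (trans (classWeight-δ R′ j₀ (w zero) j₀) (if-cong (T⇒≡true R-refl))) ⟩
    ∑[ j < k ] (if R zero (suc j) then w (suc j) else 0) ℕ.+ w zero
      ≡⟨ ℕ.+-comm _ (w zero) ⟩
    w zero ℕ.+ ∑[ j < k ] (if R zero (suc j) then w (suc j) else 0)
      ≡⟨ cong (λ b → (if b then w zero else 0) ℕ.+ ∑[ j < k ] (if R zero (suc j) then w (suc j) else 0))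
              (T⇒≡true R-refl) ⟨
    classWeight R w zero ∎
    where
    same-class : ∀ j → R (suc j₀) (suc j) ≡ R zero (suc j)
    same-class j = T-injective (mk⇔ (R-trans r₀) (R-trans (R-sym r₀)))

module _ (z : ℕ) (q : ℤ) where

  classConstantSum : (Fin k → Fin k → Bool) → (Fin k → ℕ) → ℤ
  classConstantSum {k} R w = ∑[ v ∈ vectors z k ] (if respects R v then q ^ (w · v) else 0ℤ)

  classFactor : (Fin k → Fin k → Bool) → (Fin k → ℕ) → Fin k → ℤ
  classFactor R w i = if isLeast R i then qint (classWeight R w i) z q else 1ℤ

  classProduct : (Fin k → Fin k → Bool) → (Fin k → ℕ) → ℤ
  classProduct R w = ∏ (classFactor R w)

  classFactor-nonLeast : {R : Fin k → Fin k → Bool} (w : Fin k → ℕ) {i j : Fin k} →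
                         j < i → T (R i j) → classFactor R w i ≡ 1ℤ
  classFactor-nonLeast {R = R} w j<i rij = if-cong (isLeast⁻ {R = R} j<i rij)

  module _ {R : Fin (suc k) → Fin (suc k) → Bool} (R-equiv : IsEquivalence (λ i j → T (R i j)))
           (w : Fin (suc k) → ℕ) where
    open IsEquivalence R-equiv renaming (refl to R-refl; sym to R-sym; trans to R-trans)

    private
      R′ : Fin k → Fin k → Bool
      R′ = R on suc
      w′ : Fin k → ℕ
      w′ = w ∘ suc

    classConstantSum-isolated : (∀ j → ¬ T (R zero (suc j))) →
      classConstantSum R w ≡ qint (w zero) z q * classConstantSum R′ w′
    classConstantSum-isolated isolated = begin
      classConstantSum R w
        ≡⟨ ∑-vectors-suc z _ ⟩
      ∑[ x ∈ upTo z ] ∑[ v ∈ vectors z k ]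
        (if respects R (x ∷ᵛ v) then q ^ (w zero ℕ.* x ℕ.+ w′ · v) else 0ℤ)
        ≡⟨ ∑-cong (upTo z) (λ x → ∑-cong (vectors z k) (factor-out x)) ⟩
      ∑[ x ∈ upTo z ] ∑[ v ∈ vectors z k ]
        (q ^ (w zero ℕ.* x) * (if respects R′ v then q ^ (w′ · v) else 0ℤ))
        ≡⟨ ∑-cong (upTo z) (λ x → *-distribˡ-∑ (q ^ (w zero ℕ.* x)) (vectors z k) _) ⟨
      ∑[ x ∈ upTo z ] (q ^ (w zero ℕ.* x) * classConstantSum R′ w′)
        ≡⟨ *-distribʳ-∑ (classConstantSum R′ w′) (upTo z) _ ⟨
      qint (w zero) z q * classConstantSum R′ w′ ∎
      where
      factor-out : ∀ x v →
        (if respects R (x ∷ᵛ v) then q ^ (w zero ℕ.* x ℕ.+ w′ · v) else 0ℤ)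
          ≡ q ^ (w zero ℕ.* x) * (if respects R′ v then q ^ (w′ · v) else 0ℤ)
      factor-out x v = begin
        (if respects R (x ∷ᵛ v) then q ^ (w zero ℕ.* x ℕ.+ w′ · v) else 0ℤ)
          ≡⟨ if-cong (respects-∷-isolated R-equiv isolated x v) ⟩
        (if respects R′ v then q ^ (w zero ℕ.* x ℕ.+ w′ · v) else 0ℤ)
          ≡⟨ if-cong-then (respects R′ v) (ℤ.^-distribˡ-+-* q (w zero ℕ.* x) _) ⟩
        (if respects R′ v then q ^ (w zero ℕ.* x) * q ^ (w′ · v) else 0ℤ)
          ≡⟨ if-*ˡ (respects R′ v) (q ^ (w zero ℕ.* x)) (q ^ (w′ · v)) ⟩
        q ^ (w zero ℕ.* x) * (if respects R′ v then q ^ (w′ · v) else 0ℤ) ∎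

    classProduct-isolated : (∀ j → ¬ T (R zero (suc j))) →
      classProduct R w ≡ qint (w zero) z q * classProduct R′ w′
    classProduct-isolated isolated = cong₂ _*_ factor-zero (Productℤ.sum-cong-≗ {k} factor-suc)
      where
      factor-zero : classFactor R w zero ≡ qint (w zero) z q
      factor-zero = cong₂ (λ b m → if b then qint m z q else 1ℤ)
        (isLeast⁺ {R = R} {zero} λ ()) (classWeight-isolated R-equiv isolated w)
      factor-suc : ∀ i → classFactor R w (suc i) ≡ classFactor R′ w′ i
      factor-suc i =
        cong₂ (λ b m → if b then qint m z q else 1ℤ) (isLeast-suc R ¬r) (classWeight-suc R w ¬r)
        where ¬r = isolated i ∘ R-sym

    classConstantSum-joined : ∀ {j₀} → T (R zero (suc j₀)) →
      classConstantSum R w ≡ classConstantSum R′ (contract j₀ w)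
    classConstantSum-joined {j₀} r₀ = begin
      classConstantSum R w
        ≡⟨ ∑-vectors-suc z _ ⟩
      ∑[ x ∈ upTo z ] ∑[ v ∈ vectors z k ]
        (if respects R (x ∷ᵛ v) then q ^ (w zero ℕ.* x ℕ.+ w′ · v) else 0ℤ)
        ≡⟨ ∑-cong (upTo z) (λ x → ∑-cong (vectors z k) (pinned x)) ⟩
      ∑[ x ∈ upTo z ] ∑[ v ∈ vectors z k ] (if does (lookup v j₀ ℕ.≟ x) then summand x v else 0ℤ)
        ≡⟨ ∑-comm (upTo z) (vectors z k) _ ⟩
      ∑[ v ∈ vectors z k ] ∑[ x ∈ upTo z ] (if does (lookup v j₀ ℕ.≟ x) then summand x v else 0ℤ)
        ≡⟨ ∑-cong-∈ (vectors z k) (λ {v} v∈ →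
             ∑-select ℕ._≟_ (upTo⁺ z) (All.lookup (vectors-bounded z k) v∈ j₀) (λ x → summand x v)) ⟩
      ∑[ v ∈ vectors z k ] summand (lookup v j₀) v
        ≡⟨ ∑-cong (vectors z k) (λ v → if-cong-then (respects R′ v) (cong (q ^_)
             (trans (ℕ.+-comm (w zero ℕ.* lookup v j₀) (w′ · v)) (sym (·-contract j₀ w v))))) ⟩
      classConstantSum R′ (contract j₀ w) ∎
      where
      summand : ℕ → Vec ℕ k → ℤ
      summand x v = if respects R′ v then q ^ (w zero ℕ.* x ℕ.+ w′ · v) else 0ℤ
      pinned : ∀ x v → (if respects R (x ∷ᵛ v) then q ^ (w zero ℕ.* x ℕ.+ w′ · v) else 0ℤ)
                  ≡ (if does (lookup v j₀ ℕ.≟ x) then summand x v else 0ℤ)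
      pinned x v = trans (if-cong (respects-∷-joined R-equiv r₀ x v))
        (trans (if-∧ (respects R′ v)) (if-swap-then (respects R′ v) (does (lookup v j₀ ℕ.≟ x))))

    classFactor-contract-j₀ : ∀ {j₀} → T (R zero (suc j₀)) → (∀ {j} → j < j₀ → ¬ T (R zero (suc j))) →
      classFactor R′ (contract j₀ w) j₀ ≡ classFactor R w zero
    classFactor-contract-j₀ {j₀} r₀ smallest = begin
      classFactor R′ (contract j₀ w) j₀
        ≡⟨ cong₂ (λ b m → if b then qint m z q else 1ℤ)
                 (isLeast⁺ {R = R′} λ j<j₀ r → smallest j<j₀ (R-trans r₀ r))
                 (classWeight-contract R-equiv r₀ w) ⟩
      qint (classWeight R w zero) z q
        ≡⟨ if-cong (isLeast⁺ {R = R} {zero} λ ()) ⟨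
      classFactor R w zero ∎

    classFactor-contract-outside : ∀ {j₀ i} → T (R zero (suc j₀)) → ¬ T (R zero (suc i)) →
      classFactor R′ (contract j₀ w) i ≡ classFactor R w (suc i)
    classFactor-contract-outside {j₀} {i} r₀ ¬r =
      cong₂ (λ b m → if b then qint m z q else 1ℤ) (sym (isLeast-suc R ¬r′)) weight
      where
      ¬r′ : ¬ T (R (suc i) zero)
      ¬r′ = ¬r ∘ R-sym
      weight : classWeight R′ (contract j₀ w) i ≡ classWeight R w (suc i)
      weight = begin
        classWeight R′ (contract j₀ w) i
          ≡⟨ classWeight-+ R′ w′ _ i ⟩
        classWeight R′ w′ i ℕ.+ classWeight R′ (δ j₀ (w zero)) i
          ≡⟨ cong (classWeight R′ w′ i ℕ.+_) (classWeight-δ R′ j₀ (w zero) i) ⟩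
        classWeight R′ w′ i ℕ.+ (if R (suc i) (suc j₀) then w zero else 0)
          ≡⟨ cong (classWeight R′ w′ i ℕ.+_) (if-cong (¬T⇒≡false (¬r ∘ R-trans r₀ ∘ R-sym))) ⟩
        classWeight R′ w′ i ℕ.+ 0
          ≡⟨ ℕ.+-identityʳ _ ⟩
        classWeight R′ w′ i
          ≡⟨ classWeight-suc R w ¬r′ ⟨
        classWeight R w (suc i) ∎

    classFactor-contract : ∀ {j₀} → T (R zero (suc j₀)) → (∀ {j} → j < j₀ → ¬ T (R zero (suc j))) →
      ∀ i → classFactor R′ (contract j₀ w) i
          ≡ classFactor R w (suc i) * (if does (i Fin.≟ j₀) then classFactor R w zero else 1ℤ)
    classFactor-contract {j₀} r₀ smallest i with i Fin.≟ j₀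
    ... | yes refl = begin
      classFactor R′ (contract j₀ w) j₀
        ≡⟨ classFactor-contract-j₀ r₀ smallest ⟩
      classFactor R w zero
        ≡⟨ ℤ.*-identityˡ _ ⟨
      1ℤ * classFactor R w zero
        ≡⟨ cong (_* classFactor R w zero) (classFactor-nonLeast {R = R} w {suc j₀} ℕ.z<s (R-sym r₀)) ⟨
      classFactor R w (suc j₀) * classFactor R w zero ∎
    ... | no i≢j₀ with T? (R zero (suc i))
    ...   | yes r = trans (classFactor-nonLeast {R = R′} (contract j₀ w) j₀<i (R-trans (R-sym r) r₀))
                          (sym (cong (_* 1ℤ) (classFactor-nonLeast {R = R} w {suc i} ℕ.z<s (R-sym r))))
      where
      j₀<i : j₀ < i
      j₀<i with Fin.<-cmp i j₀
      ... | tri< i<j₀ _ _ = contradiction r (smallest i<j₀)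
      ... | tri≈ _ i≡j₀ _ = contradiction i≡j₀ i≢j₀
      ... | tri> _ _ j₀<i = j₀<i
    ...   | no ¬r = trans (classFactor-contract-outside r₀ ¬r) (sym (ℤ.*-identityʳ _))

    classProduct-joined : ∀ {j₀} → T (R zero (suc j₀)) → (∀ {j} → j < j₀ → ¬ T (R zero (suc j))) →
      classProduct R w ≡ classProduct R′ (contract j₀ w)
    classProduct-joined {j₀} r₀ smallest = begin
      f zero * ∏ (f ∘ suc)
        ≡⟨ ℤ.*-comm (f zero) _ ⟩
      ∏ (f ∘ suc) * f zero
        ≡⟨ cong (∏ (f ∘ suc) *_) (sum-select ℤ.*-1-monoid j₀ (λ _ → f zero)) ⟨
      ∏ (f ∘ suc) * ∏ (λ i → if does (i Fin.≟ j₀) then f zero else 1ℤ)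
        ≡⟨ Productℤ.∑-distrib-+ (f ∘ suc) _ ⟨
      ∏ (λ i → f (suc i) * (if does (i Fin.≟ j₀) then f zero else 1ℤ))
        ≡⟨ Productℤ.sum-cong-≗ {k} (classFactor-contract r₀ smallest) ⟨
      classProduct R′ (contract j₀ w) ∎
      where
      f = classFactor R w

  classConstantSum≡classProduct : (R : Fin k → Fin k → Bool) (w : Fin k → ℕ) →
    IsEquivalence (λ i j → T (R i j)) → classConstantSum R w ≡ classProduct R w
  classConstantSum≡classProduct {zero}  R w _ = refl
  classConstantSum≡classProduct {suc k} R w R-equiv with smallest-or-none (λ j → R zero (suc j))
  ... | inj₁ isolated = begin
    classConstantSum R w
      ≡⟨ classConstantSum-isolated R-equiv w isolated ⟩
    qint (w zero) z q * classConstantSum (R on suc) (w ∘ suc)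
      ≡⟨ cong (qint (w zero) z q *_)
              (classConstantSum≡classProduct (R on suc) (w ∘ suc) (On.isEquivalence suc R-equiv)) ⟩
    qint (w zero) z q * classProduct (R on suc) (w ∘ suc)
      ≡⟨ classProduct-isolated R-equiv w isolated ⟨
    classProduct R w ∎
  ... | inj₂ (j₀ , r₀ , smallest) = begin
    classConstantSum R w
      ≡⟨ classConstantSum-joined R-equiv w r₀ ⟩
    classConstantSum (R on suc) (contract j₀ w)
      ≡⟨ classConstantSum≡classProduct (R on suc) (contract j₀ w) (On.isEquivalence suc R-equiv) ⟩
    classProduct (R on suc) (contract j₀ w)
      ≡⟨ classProduct-joined R-equiv w r₀ smallest ⟨
    classProduct R w ∎

-- Connectivity

EdgeIn : List (Edge k) → Fin k → Fin k → Set
EdgeIn A i j = (i , j) ∈ A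

=ᶠ-refl : (i : Fin k) → T (i =ᶠ i)
=ᶠ-refl i = ℕ.≡⇒≡ᵇ (toℕ i) (toℕ i) refl

=ᶠ⇒≡ : {i j : Fin k} → T (i =ᶠ j) → i ≡ j
=ᶠ⇒≡ {i = i} {j} t = Fin.toℕ-injective (ℕ.≡ᵇ⇒≡ (toℕ i) (toℕ j) t)

module _ {k : ℕ} {A : List (Edge k)} {i : Fin k} where

  Reach : ℕ → Fin k → Set
  Reach t j = T (reachIn t A i j)

  Reach-suc⁺ : ∀ t {p j} → Reach t p → SymClosure (EdgeIn A) p j → Reach (suc t) j
  Reach-suc⁺ t {p} {j} h (fwd pj∈A) = from (T-∨ {reachIn t A i j})
    (inj₂ (any⁺ _ (lose pj∈A (from T-∨ (inj₁ (from T-∧ (h , =ᶠ-refl j)))))))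
  Reach-suc⁺ t {p} {j} h (bwd jp∈A) = from (T-∨ {reachIn t A i j})
    (inj₂ (any⁺ _ (lose jp∈A (from (T-∨ {reachIn t A i j ∧ (p =ᶠ j)})
                                   (inj₂ (from T-∧ (h , =ᶠ-refl j)))))))

  Reach-suc⁻ : ∀ t {j} → Reach (suc t) j → Reach t j ⊎ ∃[ p ] (Reach t p × SymClosure (EdgeIn A) p j)
  Reach-suc⁻ t {j} h with to (T-∨ {reachIn t A i j}) h
  ... | inj₁ h′ = inj₁ h′
  ... | inj₂ h′ with (a , b) , ab∈A , via ← find (any⁻ _ A h′)
                with to (T-∨ {reachIn t A i a ∧ (b =ᶠ j)}) via
  ... | inj₁ via-a = let ha , b=j = to T-∧ via-a in
    inj₂ (a , ha , fwd (subst (λ c → (a , c) ∈ A) (=ᶠ⇒≡ b=j) ab∈A))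
  ... | inj₂ via-b = let hb , a=j = to T-∧ via-b in
    inj₂ (b , hb , bwd (subst (λ c → (c , b) ∈ A) (=ᶠ⇒≡ a=j) ab∈A))

  Reach-incl : ∀ t → Reach t ⊆ Reach (suc t)
  Reach-incl t {j} h = from (T-∨ {reachIn t A i j}) (inj₁ h)

  Reach⇒EqClosure : ∀ t {j} → Reach t j → EqClosure (EdgeIn A) i j
  Reach⇒EqClosure zero    h = subst (EqClosure (EdgeIn A) i) (=ᶠ⇒≡ h) Star.ε
  Reach⇒EqClosure (suc t) h with Reach-suc⁻ t h
  ... | inj₁ h′            = Reach⇒EqClosure t h′
  ... | inj₂ (p , h′ , pj) = Reach⇒EqClosure t h′ ◅◅ pj ◅ Star.ε

  Reach-extend : ∀ t {p j} → Reach t p → EqClosure (EdgeIn A) p j → ∃[ u ] Reach u j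
  Reach-extend t h Star.ε        = t , h
  Reach-extend t h (edge ◅ path) = Reach-extend (suc t) (Reach-suc⁺ t h edge) path

  Reach-mono : ∀ {t u} → t ℕ.≤′ u → Reach t ⊆ Reach u
  Reach-mono ℕ.≤′-refl              = id
  Reach-mono (ℕ.≤′-step {u} t≤′u) = Reach-incl u ∘ Reach-mono t≤′u

  Reach-stuck : ∀ {t u} → Reach (suc t) ⊆ Reach t → t ℕ.≤′ u → Reach u ⊆ Reach t
  Reach-stuck stuck ℕ.≤′-refl = id
  Reach-stuck {t} stuck (ℕ.≤′-step {u} t≤′u) h with Reach-suc⁻ u h
  ... | inj₁ h′            = Reach-stuck stuck t≤′u h′
  ... | inj₂ (p , h′ , pj) = stuck (Reach-suc⁺ t (Reach-stuck stuck t≤′u h′) pj)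

  reached : ℕ → Subset k
  reached t = Vec.tabulate (reachIn t A i)

  Reach⇒∈ : ∀ t {j} → Reach t j → j ∈ₛ reached t
  Reach⇒∈ t {j} h =
    Vec.lookup⇒[]= j (reached t) (trans (Vec.lookup∘tabulate (reachIn t A i) j) (T⇒≡true h))

  ∈⇒Reach : ∀ t {j} → j ∈ₛ reached t → Reach t j
  ∈⇒Reach t {j} j∈ =
    from T-≡ (trans (sym (Vec.lookup∘tabulate (reachIn t A i) j)) (Vec.[]=⇒lookup j∈))

  Reach-grows : ∀ n → (∃[ t ] t ℕ.< n × Reach (suc t) ⊆ Reach t) ⊎ n ℕ.≤ ∣ reached n ∣
  Reach-grows zero = inj₂ ℕ.z≤n
  Reach-grows (suc n) with Reach-grows n
  ... | inj₁ (t , t<n , stuck) = inj₁ (t , ℕ.m<n⇒m<1+n t<n , stuck)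
  ... | inj₂ n≤∣reached∣ with reached n ⊂? reached (suc n)
  ...   | yes grew = inj₂ (ℕ.≤-<-trans n≤∣reached∣ (p⊂q⇒∣p∣<∣q∣ grew))
  ...   | no ¬grew = inj₁ (n , ℕ.≤-refl , λ {j} h → decidable-stable (T? _) λ ¬h →
      ¬grew (Reach⇒∈ (suc n) ∘ Reach-incl n ∘ ∈⇒Reach n , j , Reach⇒∈ (suc n) h , ¬h ∘ ∈⇒Reach n))

  -- A strictly increasing chain of subsets of Fin k has at most k + 1 members.
  Reach-stabilises : ∃[ t ] t ℕ.≤ k × Reach (suc t) ⊆ Reach t
  Reach-stabilises with Reach-grows (suc k)
  ... | inj₁ (t , t<1+k , stuck) = t , ℕ.s≤s⁻¹ t<1+k , stuck
  ... | inj₂ 1+k≤∣reached∣ =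
    contradiction (ℕ.≤-trans 1+k≤∣reached∣ (∣p∣≤n (reached (suc k)))) ℕ.1+n≰n

  Reach⇒connected : ∀ t {j} → Reach t j → T (connected A i j)
  Reach⇒connected t h with t₀ , t₀≤k , stuck ← Reach-stabilises with ℕ.≤-total t t₀
  ... | inj₁ t≤t₀ = Reach-mono (ℕ.≤⇒≤′ t₀≤k) (Reach-mono (ℕ.≤⇒≤′ t≤t₀) h)
  ... | inj₂ t₀≤t = Reach-mono (ℕ.≤⇒≤′ t₀≤k) (Reach-stuck stuck (ℕ.≤⇒≤′ t₀≤t) h)

connected-⇔ : (A : List (Edge k)) {i j : Fin k} → T (connected A i j) ⇔ EqClosure (EdgeIn A) i j
connected-⇔ {k} A {i} = mk⇔ (Reach⇒EqClosure k) λ path →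
  let t , h = Reach-extend 0 (=ᶠ-refl i) path in Reach⇒connected t h

connected-isEquivalence : (A : List (Edge k)) → IsEquivalence (λ i j → T (connected A i j))
connected-isEquivalence A = record
  { refl  = from (connected-⇔ A) Star.ε
  ; sym   = from (connected-⇔ A) ∘ EqClosure.symmetric (EdgeIn A) ∘ to (connected-⇔ A)
  ; trans = λ ij jl → from (connected-⇔ A) (to (connected-⇔ A) ij ◅◅ to (connected-⇔ A) jl)
  }

-- The q-chromatic function

monochromaticEdge : Vec ℕ k → Edge k → Bool
monochromaticEdge v e = lookup v (proj₁ e) ℕ.≡ᵇ lookup v (proj₂ e)

monochromatic : List (Edge k) → Vec ℕ k → Bool
monochromatic A v = all (monochromaticEdge v) A

monochromatic≡respects : (A : List (Edge k)) (v : Vec ℕ k) →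
                         monochromatic A v ≡ respects (connected A) v
monochromatic≡respects A v = T-injective (mk⇔ along-paths on-edges)
  where
  along-paths : T (monochromatic A v) → T (respects (connected A) v)
  along-paths mono = from (respects-⇔ (connected A) v) λ i j c →
    EqClosure.gfold ≡.isEquivalence (lookup v)
      (λ e∈A → ℕ.≡ᵇ⇒≡ _ _ (All.lookup (all⁺ _ A mono) e∈A)) (to (connected-⇔ A) c)
  on-edges : T (respects (connected A) v) → T (monochromatic A v)
  on-edges resp = all⁻ _ (All.tabulate λ {e} e∈A → ℕ.≡⇒≡ᵇ _ _
    (to (respects-⇔ (connected A) v) resp (proj₁ e) (proj₂ e)
        (from (connected-⇔ A) (fwd e∈A ◅ Star.ε))))

prodℤ-filter : (p : A → Bool) (h : A → ℤ) (xs : List A) →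
  prodℤ (map h (filter (λ x → p x Bool.≟ true) xs)) ≡ prodℤ (map (λ x → if p x then h x else 1ℤ) xs)
prodℤ-filter p h []       = refl
prodℤ-filter p h (x ∷ xs) with p x
... | true  = cong (h x *_) (prodℤ-filter p h xs)
... | false = trans (prodℤ-filter p h xs) (sym (ℤ.*-identityˡ _))

prodℤ-tabulate : ∀ {n} (h : A → ℤ) (g : Fin n → A) → prodℤ (map h (tabulate g)) ≡ ∏ (h ∘ g)
prodℤ-tabulate {n = zero}  h g = refl
prodℤ-tabulate {n = suc n} h g = cong (h (g zero) *_) (prodℤ-tabulate h (g ∘ suc))

length-filter-tabulate : ∀ {n} (p : A → Bool) (g : Fin n → A) →
  length (filter (λ x → p x Bool.≟ true) (tabulate g)) ≡ ∑[ j < n ] (if p (g j) then 1 else 0)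
length-filter-tabulate {n = zero}  p g = refl
length-filter-tabulate {n = suc n} p g with p (g zero)
... | true  = cong suc (length-filter-tabulate p (g ∘ suc))
... | false = length-filter-tabulate p (g ∘ suc)

componentSizes-product : (z : ℕ) (q : ℤ) (A : List (Edge k)) →
  prodℤ (map (λ m → qint m z q) (componentSizes A)) ≡ classProduct z q (connected A) (λ _ → 1)
componentSizes-product {k} z q A = begin
  prodℤ (map (λ m → qint m z q) (map size representatives))
    ≡⟨ cong prodℤ (List.map-∘ representatives) ⟨
  prodℤ (map (λ i → qint (size i) z q) representatives)
    ≡⟨ prodℤ-filter (isRep A) (λ i → qint (size i) z q) (allFin k) ⟩
  prodℤ (map (λ i → if isRep A i then qint (size i) z q else 1ℤ) (allFin k))
    ≡⟨ prodℤ-tabulate (λ i → if isRep A i then qint (size i) z q else 1ℤ) id ⟩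
  ∏ (λ i → if isRep A i then qint (size i) z q else 1ℤ)
    ≡⟨ Productℤ.sum-cong-≗ {k} (λ i →
         if-cong-then (isRep A i) (cong (λ m → qint m z q) (length-filter-tabulate (connected A i) id))) ⟩
  classProduct z q (connected A) (λ _ → 1) ∎
  where
  representatives = filter (λ i → isRep A i Bool.≟ true) (allFin k)
  size : Fin k → ℕ
  size i = length (component A i)

monochromatic-sum : (z : ℕ) (q : ℤ) (A : List (Edge k)) →
  ∑[ v ∈ vectors z k ] (if monochromatic A v then q ^ Vec.sum v else 0ℤ)
    ≡ prodℤ (map (λ m → qint m z q) (componentSizes A))
monochromatic-sum {k} z q A = begin
  ∑[ v ∈ vectors z k ] (if monochromatic A v then q ^ Vec.sum v else 0ℤ)
    ≡⟨ ∑-cong (vectors z k) (λ v → cong₂ (λ b n → if b then q ^ n else 0ℤ)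
         (monochromatic≡respects A v) (sym (·-const-1 v))) ⟩
  classConstantSum z q (connected A) (λ _ → 1)
    ≡⟨ classConstantSum≡classProduct z q (connected A) (λ _ → 1) (connected-isEquivalence A) ⟩
  classProduct z q (connected A) (λ _ → 1)
    ≡⟨ componentSizes-product z q A ⟨
  prodℤ (map (λ m → qint m z q) (componentSizes A)) ∎

theorem1p2 : (k : ℕ) (E : List (Edge k)) →
    All (λ e → proj₁ e < proj₂ e) E → Unique E →
    (z : ℕ) → 1 ≤ z → (q : ℤ) →
    Mq E z q ≡ rhs E z q
theorem1p2 k E _ _ z _ q = begin
  Mq E z q
    ≡⟨ ∑-cong (vectors z k) (λ v → inclusion-exclusion (monochromaticEdge v) (q ^ Vec.sum v) E) ⟩
  ∑[ v ∈ vectors z k ] ∑[ A ∈ subsets E ]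
    (-1ℤ ^ length A * (if monochromatic A v then q ^ Vec.sum v else 0ℤ))
    ≡⟨ ∑-comm (vectors z k) (subsets E) _ ⟩
  ∑[ A ∈ subsets E ] ∑[ v ∈ vectors z k ]
    (-1ℤ ^ length A * (if monochromatic A v then q ^ Vec.sum v else 0ℤ))
    ≡⟨ ∑-cong (subsets E) (λ A → trans (sym (*-distribˡ-∑ (-1ℤ ^ length A) (vectors z k) _))
                                        (cong (-1ℤ ^ length A *_) (monochromatic-sum z q A))) ⟩
  rhs E z q ∎
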